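{- If $G$ is a connected graph with no induced cycle of length $4$ and $\theta(G)\leq 2$, then $c(G) = 1$.
   Context: All graphs are finite and simple. $\theta(G)$ is the clique cover number: the least number of cliques whose vertex sets partition $V(G)$. The Cops and Robbers game on $G$: first $m$ cops are placed on vertices, then the robber is placed; players alternate turns starting with the cops; on a turn each cop (resp. the robber) moves to an adjacent vertex or stays. The cops win if after finitely many moves a cop occupies the robber's vertex. The cop number $c(G)$ is the least $m$ such that $m$ cops can always win. -}

module Defs where

open import Data.Nat using (ℕ; _≤_)
open import Data.Fin using (Fin)
open import Data.Product using (Σ; ∃; _×_; _,_)
open import Data.Sum using (_⊎_)
open import Relation.Nullary using (¬_)
open import Relation.Binary using (Rel; Decidable)
open import Relation.Binary.PropositionalEquality using (_≡_; _≢_)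
open import Level using (0ℓ)

record Graph : Set₁ where
  field
    n      : ℕ
    Adj    : Rel (Fin n) 0ℓ
    sym    : ∀ {u v} → Adj u v → Adj v u
    irrefl : ∀ {u} → ¬ Adj u u
    dec    : Decidable Adj

module _ (G : Graph) where
  open Graph G

  V : Set
  V = Fin n

  Move : V → V → Set
  Move u v = u ≡ v ⊎ Adj u v

  data Reach : V → V → Set where
    here  : ∀ {u} → Reach u u
    there : ∀ {u w v} → Adj u w → Reach w v → Reach u v

  Connected : Set
  Connected = V × (∀ u v → Reach u v)

  HasInducedC4 : Set
  HasInducedC4 = Σ V λ a → Σ V λ b → Σ V λ c → Σ V λ d →
    (a ≢ b × a ≢ c × a ≢ d × b ≢ c × b ≢ d × c ≢ d) ×
    (Adj a b × Adj b c × Adj c d × Adj d a) ×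
    (¬ Adj a c × ¬ Adj b d)

  CliquePartition : ℕ → Set
  CliquePartition k = Σ (V → Fin k) λ f →
    ∀ u v → f u ≡ f v → u ≢ v → Adj u v

  θ≤ : ℕ → Set
  θ≤ k = CliquePartition k

  -- Position: cop placement (Fin m → V)
  -- and robber vertex; cops to move.  CopWinFrom cs r holds iff the cops
  -- can force capture in finitely many moves (well-founded game tree).
  Captured : ∀ {m} → (Fin m → V) → V → Set
  Captured cs r = ∃ λ i → cs i ≡ r

  data CopWinFrom {m : ℕ} (cs : Fin m → V) (r : V) : Set where
    caught : Captured cs r → CopWinFrom cs r
    move   : (cs' : Fin m → V) → (∀ i → Move (cs i) (cs' i)) →
             (Captured cs' r ⊎ (∀ r' → Move r r' → CopWinFrom cs' r')) →
             CopWinFrom cs r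

  -- m cops win: cops are placed first, then the robber, cops move first
  CopsWin : ℕ → Set
  CopsWin m = Σ (Fin m → V) λ cs → ∀ r → CopWinFrom cs r

  CopNumberIs : ℕ → Set
  CopNumberIs m = CopsWin m × (∀ k → CopsWin k → m ≤ k)

{-# OPTIONS --safe #-}
-- Let A and B be the two cliques.  If a, a' ∈ A had neighbours b' ∈ N(a) ∖ N(a')
-- and b ∈ N(a') ∖ N(a) in B, then a b' b a' would be an induced 4-cycle; so the
-- B-neighbourhoods of the vertices of A form a chain, and the cop starts on a
-- vertex a of A whose B-neighbourhood is largest.  A robber out of reach of a
-- sits in B and has no neighbour in A, so he can never leave B, while by
-- connectivity a has a neighbour in B, and from there the cop dominates B.
module Submission where

open import Data.Empty using (⊥-elim)
open import Data.Fin using (Fin; zero; suc; _≟_)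
open import Data.Fin.Properties using (any?)
open import Data.Nat using (ℕ; _≤_; z≤n; s≤s)
open import Data.Product using (∃; ∃₂; _×_; _,_; proj₁)
open import Data.Sum using (_⊎_; inj₁; inj₂)
open import Function using (const; _∘_)
open import Level using (Level; 0ℓ)
open import Relation.Binary using (Rel; Reflexive; Transitive)
open import Relation.Binary.PropositionalEquality using (_≡_; _≢_; refl; sym; trans; ≢-sym)
open import Relation.Nullary using (¬_; yes; no; ¬?; _×-dec_; _⊎-dec_)
open import Relation.Nullary.Decidable using (decidable-stable)
open import Relation.Unary using (Pred; Decidable)

open import Defs

private
  variable
    ℓ ℓ′ : Level

greatest-or-empty : ∀ {n} {P : Pred (Fin n) ℓ} {_≼_ : Rel (Fin n) ℓ′} →
  Decidable P → Reflexive _≼_ → Transitive _≼_ →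
  (∀ {x y} → P x → P y → x ≼ y ⊎ y ≼ x) →
  (∀ x → ¬ P x) ⊎ ∃ λ m → P m × (∀ {x} → P x → x ≼ m)
greatest-or-empty {n = ℕ.zero} _ _ _ _ = inj₁ λ ()
greatest-or-empty {n = ℕ.suc n} {P} {_≼_} P? ≼-refl ≼-trans total
  with greatest-or-empty {P = λ x → P (suc x)} {_≼_ = λ x y → suc x ≼ suc y}
         (λ x → P? (suc x)) ≼-refl ≼-trans total
     | P? zero
... | inj₁ none | no ¬p₀ = inj₁ λ { zero → ¬p₀ ; (suc x) → none x }
... | inj₁ none | yes p₀ =
  inj₂ (zero , p₀ , λ { {zero} _ → ≼-refl ; {suc x} p → ⊥-elim (none x p) })
... | inj₂ (m , pm , max) | no ¬p₀ =
  inj₂ (suc m , pm , λ { {zero} p₀ → ⊥-elim (¬p₀ p₀) ; {suc x} p → max p })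
... | inj₂ (m , pm , max) | yes p₀ with total p₀ pm
...   | inj₁ 0≼m = inj₂ (suc m , pm , λ { {zero} _ → 0≼m ; {suc x} p → max p })
...   | inj₂ m≼0 =
  inj₂ (zero , p₀ , λ { {zero} _ → ≼-refl ; {suc x} p → ≼-trans (max p) m≼0 })

module _ (G : Graph) where
  open Graph G renaming (sym to Adj-sym)

  adjacent⇒distinct : ∀ {u v} → Adj u v → u ≢ v
  adjacent⇒distinct uv refl = irrefl uv

  induced-C4 : ∀ {a b c d} → Adj a b → Adj b c → Adj c d → Adj d a →
    ¬ Adj a c → ¬ Adj b d → a ≢ c → b ≢ d → HasInducedC4 G
  induced-C4 ab bc cd da ¬ac ¬bd a≢c b≢d =
    _ , _ , _ , _ ,
    (adjacent⇒distinct ab , a≢c , ≢-sym (adjacent⇒distinct da) ,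
     adjacent⇒distinct bc , b≢d , adjacent⇒distinct cd) ,
    (ab , bc , cd , da) , (¬ac , ¬bd)

  crossing-edge : ∀ {P : Pred (V G) ℓ} {u v} → Decidable P →
    Reach G u v → P u → ¬ P v → ∃₂ λ x y → P x × ¬ P y × Adj x y
  crossing-edge P? here pu ¬pv = ⊥-elim (¬pv pu)
  crossing-edge P? (there {w = w} uw w⇝v) pu ¬pv with P? w
  ... | yes pw = crossing-edge P? w⇝v pw ¬pv
  ... | no ¬pw = _ , w , pu , ¬pw , uw

  no-cops-lose : ∀ {cs : Fin 0 → V G} {r} → ¬ CopWinFrom G cs r
  no-cops-lose (caught (() , _))
  no-cops-lose (move _ _ (inj₁ (() , _)))
  no-cops-lose (move _ _ (inj₂ win)) = no-cops-lose (win _ (inj₁ refl))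

  cop-number-positive : V G → ∀ k → CopsWin G k → 1 ≤ k
  cop-number-positive r ℕ.zero (_ , win) = ⊥-elim (no-cops-lose (win r))
  cop-number-positive r (ℕ.suc k) _ = s≤s z≤n

  capture-next : ∀ {c r} → Move G c r → CopWinFrom G {1} (const c) r
  capture-next {r = r} c→r = move (const r) (const c→r) (inj₁ (zero , refl))

  capture-in-two : ∀ {c c′ r} → Move G c c′ →
    (∀ {r′} → Move G r r′ → Move G c′ r′) →
    CopWinFrom G {1} (const c) r
  capture-in-two {c′ = c′} c→c′ dominates =
    move (const c′) (const c→c′) (inj₂ λ _ r→r′ → capture-next (dominates r→r′))

module TwoCliques (G : Graph) (noC4 : ¬ HasInducedC4 G) (class : V G → Fin 2)
  (clique : ∀ u v → class u ≡ class v → u ≢ v → Graph.Adj G u v) where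
  open Graph G renaming (sym to Adj-sym)

  InA InB : Pred (V G) 0ℓ
  InA x = class x ≡ zero
  InB x = class x ≡ suc zero

  ¬InA⇒InB : ∀ {x} → ¬ InA x → InB x
  ¬InA⇒InB {x} with class x
  ... | zero = λ ¬ia → ⊥-elim (¬ia refl)
  ... | suc zero = λ _ → refl

  InB⇒¬InA : ∀ {x} → InB x → ¬ InA x
  InB⇒¬InA ib ia with trans (sym ia) ib
  ... | ()

  A≢B : ∀ {u v} → InA u → InB v → u ≢ v
  A≢B ia ib refl = InB⇒¬InA ib ia

  same-class⇒Move : ∀ {u v} → class u ≡ class v → Move G u v
  same-class⇒Move {u} {v} eq with u ≟ v
  ... | yes u≡v = inj₁ u≡v
  ... | no u≢v = inj₂ (clique u v eq u≢v)

  _≼_ : Rel (V G) 0ℓ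
  x ≼ y = ∀ {b} → InB b → Adj x b → Adj y b

  ≼-refl : Reflexive _≼_
  ≼-refl _ xb = xb

  ≼-trans : Transitive _≼_
  ≼-trans x≼y y≼z ib xb = y≼z ib (x≼y ib xb)

  ≼-total-on-A : ∀ {a a′} → InA a → InA a′ → a ≼ a′ ⊎ a′ ≼ a
  ≼-total-on-A {a} {a′} ia ia′
    with any? (λ b → class b ≟ suc zero ×-dec dec a b ×-dec ¬? (dec a′ b))
  ... | no ∄b′ = inj₁ λ {b} ib ab →
    decidable-stable (dec a′ b) λ ¬a′b → ∄b′ (b , ib , ab , ¬a′b)
  ... | yes (b′ , ib′ , ab′ , ¬a′b′) = inj₂ λ {b} ib a′b →
    decidable-stable (dec a b) λ ¬ab → noC4
      (induced-C4 G ab′ (clique b′ b (trans ib′ (sym ib)) λ { refl → ¬ab ab′ })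
                  (Adj-sym a′b) (clique a′ a (trans ia′ (sym ia)) λ { refl → ¬ab a′b })
                  ¬ab (¬a′b′ ∘ Adj-sym) (A≢B ia ib) (≢-sym (A≢B ia′ ib′)))

  trapped-in-B : ∀ {r r′} → InB r → (∀ {x} → InA x → ¬ Adj x r) →
    Move G r r′ → InB r′
  trapped-in-B ib _ (inj₁ refl) = ib
  trapped-in-B _ isolated (inj₂ rr′) = ¬InA⇒InB λ ia → isolated ia (Adj-sym rr′)

  out-of-reach⇒InB : ∀ {a r} → InA a → ¬ Move G a r → InB r
  out-of-reach⇒InB ia a↛r = ¬InA⇒InB λ ir → a↛r (same-class⇒Move (trans ia (sym ir)))

  greatest-guards : ∀ {a r} → InA a → (∀ {x} → InA x → x ≼ a) → Reach G a r →
    CopWinFrom G (const a) r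
  greatest-guards {a} {r} ia greatest a⇝r with a ≟ r ⊎-dec dec a r
  ... | yes a→r = capture-next G a→r
  ... | no a↛r
    with crossing-edge G (λ x → class x ≟ zero) a⇝r ia
           (InB⇒¬InA (out-of-reach⇒InB ia a↛r))
  ...   | _ , y , ix , ¬iy , xy = capture-in-two G (inj₂ ay) λ r→r′ →
    same-class⇒Move (trans iy (sym (trapped-in-B ib isolated r→r′)))
    where
    ib : InB r
    ib = out-of-reach⇒InB ia a↛r
    iy : InB y
    iy = ¬InA⇒InB ¬iy
    ay : Adj a y
    ay = greatest ix iy xy
    isolated : ∀ {x} → InA x → ¬ Adj x r
    isolated ix xr = a↛r (inj₂ (greatest ix ib xr))

  one-cop-wins : Connected G → CopsWin G 1
  one-cop-wins (v₀ , reach)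
    with greatest-or-empty {_≼_ = _≼_} (λ x → class x ≟ zero)
           ≼-refl ≼-trans ≼-total-on-A
  ... | inj₁ no-A = const v₀ , λ r →
    capture-next G (same-class⇒Move
      (trans (¬InA⇒InB (no-A v₀)) (sym (¬InA⇒InB (no-A r)))))
  ... | inj₂ (a , ia , greatest) = const a , λ r → greatest-guards ia greatest (reach a r)

lemma4p3 : (G : Graph) → Connected G → ¬ HasInducedC4 G → θ≤ G 2 →
    CopNumberIs G 1
lemma4p3 G connected noC4 (class , clique) =
  TwoCliques.one-cop-wins G noC4 class clique connected ,
  cop-number-positive G (proj₁ connected)
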